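{- For every odd integer $n\geq3$, if $A$ is chosen uniformly at random from the set $Sol_n$ of solvable boards of size $n$, then: (1) $\mathrm{Prob}(\text{length } A=1)>\frac13$; (2) $\mathrm{Prob}(\text{length } A=2)>\frac{5}{32}$; (3) $\mathrm{Prob}(\text{length } A=3)>\left(1-(\tfrac{63}{64})^{n-2}\right)\cdot\frac{49}{96}$; (4) $\mathrm{Prob}(\text{length } A=k)<(\tfrac{63}{64})^{n-2}\cdot\frac{49}{96}$ for every integer $k\geq4$.
   Context: Let $\mathcal{D}=\{\mathrm{N},\mathrm{NE},\mathrm{E},\mathrm{SE},\mathrm{S},\mathrm{SW},\mathrm{W},\mathrm{NW}\}$. For odd $n\geq 3$, a board of size $n$ is an $n\times n$ matrix $A=(a_{ij})$ with entries in $\mathcal{D}$; rows are indexed $1,\dots,n$ from top to bottom, columns from left to right. For $(i',j')\neq(i,j)$, $a_{ij}$ is directing to $(i',j')$ if: N: $j'=j$, $i'<i$; NE: $i-i'=j'-j>0$; E: $i'=i$, $j'>j$; SE: $i'-i=j'-j>0$; S: $j'=j$, $i'>i$; SW: $i'-i=j-j'>0$; W: $i'=i$, $j'<j$; NW: $i-i'=j-j'>0$. A move goes from $(i,j)$ to any position to which $a_{ij}$ is directing. $A$ is solvable if some finite sequence of moves leads from $(1,1)$ to the center $(\frac{n+1}{2},\frac{n+1}{2})$; the length of a solvable board is the minimal number of moves in such a sequence. $Sol_n$ is the set of solvable boards of size $n$ with the uniform probability measure. -}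

module Defs where

open import Data.Nat using (ℕ; zero; suc; _+_; _*_; _∸_; _^_; _≤_; _<_)
open import Data.Fin using (Fin; toℕ; fromℕ; _↑ˡ_)
open import Data.Vec using (Vec; lookup)
open import Data.Product using (Σ; ∃; ∃-syntax; _×_; _,_)
open import Relation.Binary.PropositionalEquality using (_≡_)
open import Relation.Nullary using (¬_)
open import Function.Bundles using (_⇔_)
open import Function.Definitions using (Injective)

data Dir : Set where
  N NE E SE S SW W NW : Dir

-- A board of size n: an n×n matrix with entries in Dir (rows top to bottom,
-- columns left to right; indices are 0-based Fin n, i.e. shifted by one).
Board : ℕ → Set
Board n = Vec (Vec Dir n) n

Pos : ℕ → Set
Pos n = Fin n × Fin n

entry : ∀ {n} → Board n → Pos n → Dir
entry A (i , j) = lookup (lookup A i) j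

Directing : ∀ {n} → Dir → Pos n → Pos n → Set
Directing N  (i , j) (i' , j') = toℕ j' ≡ toℕ j × ∃[ δ ] toℕ i ≡ toℕ i' + suc δ
Directing NE (i , j) (i' , j') = ∃[ δ ] (toℕ i ≡ toℕ i' + suc δ × toℕ j' ≡ toℕ j + suc δ)
Directing E  (i , j) (i' , j') = toℕ i' ≡ toℕ i × ∃[ δ ] toℕ j' ≡ toℕ j + suc δ
Directing SE (i , j) (i' , j') = ∃[ δ ] (toℕ i' ≡ toℕ i + suc δ × toℕ j' ≡ toℕ j + suc δ)
Directing S  (i , j) (i' , j') = toℕ j' ≡ toℕ j × ∃[ δ ] toℕ i' ≡ toℕ i + suc δ
Directing SW (i , j) (i' , j') = ∃[ δ ] (toℕ i' ≡ toℕ i + suc δ × toℕ j ≡ toℕ j' + suc δ)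
Directing W  (i , j) (i' , j') = toℕ i' ≡ toℕ i × ∃[ δ ] toℕ j ≡ toℕ j' + suc δ
Directing NW (i , j) (i' , j') = ∃[ δ ] (toℕ i ≡ toℕ i' + suc δ × toℕ j ≡ toℕ j' + suc δ)

Move : ∀ {n} → Board n → Pos n → Pos n → Set
Move A p q = Directing (entry A p) p q

start : ∀ {h} → Pos (suc h)
start = Fin.zero , Fin.zero
  where import Data.Fin as Fin

-- Boards of odd size n = 2h+1; the center ((n+1)/2,(n+1)/2) is 0-based index h.
center : ∀ h → Pos (suc (h + h))
center h = fromℕ h ↑ˡ h , fromℕ h ↑ˡ h

ReachIn : ∀ {h} → Board (suc h) → ℕ → Pos (suc h) → Set
ReachIn A zero p = p ≡ start
ReachIn A (suc k) p = ∃[ q ] (ReachIn A k q × Move A q p)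

Solvable : ∀ h → Board (suc (h + h)) → Set
Solvable h A = ∃[ k ] ReachIn A k (center h)

HasLength : ∀ h → Board (suc (h + h)) → ℕ → Set
HasLength h A k = ReachIn A k (center h) × (∀ j → j < k → ¬ ReachIn A j (center h))

IsCard : {X : Set} → (X → Set) → ℕ → Set
IsCard {X} P c = Σ (Fin c → X) λ f → Injective _≡_ _≡_ f × (∀ x → P x ⇔ (∃[ i ] f i ≡ x))

-- Each estimate compares the sizes of two finite sets through an explicit injection.
-- A board has length 1 iff its start cell points SE, and a solvable board starts E, S or SE;
-- so resetting the start to SE maps the solvable boards at most 3-to-1 to length-1 boards, and
-- the unsolvable board pointing SE everywhere except E at the start makes (1) strict.
-- For (2) and (3) a length-1 board is rewritten on a frame of cells (the start, the top-right
-- corner and, for each of the n − 2 inner columns, its top cell and a partner in the middle row)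
-- into a board that starts E and has length exactly 2, resp. 3; the overwritten entries are
-- recorded, one bit of them in whether the new board is transposed. In (3) a column whose two
-- entries give the path top cell → middle row → centre is an event; column data without an
-- event avoid one of 64 values in every column, which produces the factor (63/64)^(n−2).
-- The length classes are disjoint sets of solvable boards, so (4) follows from (1)–(3).

module Submission where

open import Data.Empty using (⊥-elim)
open import Data.Fin using (Fin; zero; suc; toℕ; fromℕ; fromℕ<; inject₁; _↑ˡ_; punchIn; punchOut; _≟_)
open import Data.Fin.Patterns using (0F; 1F; 2F; 3F; 4F; 5F; 6F; 7F)
open import Data.Fin.Properties
  using (+↔⊎; *↔×; 1↔⊤; injective⇒≤; inj⇒≟; any?; <-cmp; <-irrefl; toℕ-injective; toℕ-fromℕ; toℕ-fromℕ<;
         toℕ-↑ˡ; toℕ-inject₁; inject₁-injective; fromℕ≢inject₁; punchInᵢ≢i; punchIn-injective; punchOut-injective)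
open import Data.Fin.Relation.Unary.Top using (view; ‵fromℕ; ‵inject₁; view-fromℕ; view-inject₁)
open import Data.Maybe using (Maybe; just; nothing; maybe)
open import Data.Nat using (ℕ; zero; suc; s≤s; z≤n; _+_; _*_; _∸_; _^_; _≤_; _<_; >-nonZero)
import Data.Nat.Properties as ℕ
open import Data.Nat.Solver using (module +-*-Solver)
open import Data.Product using (∃-syntax; _×_; _,_; proj₁; proj₂; uncurry; swap)
open import Data.Product.Function.NonDependent.Propositional using (_×-↔_)
open import Data.Product.Properties using (,-injectiveˡ; ,-injectiveʳ; ≡-dec)
open import Data.Sum using (_⊎_; inj₁; inj₂)
open import Data.Sum.Function.Propositional using (_⊎-↔_)
open import Data.Sum.Properties using (inj₁-injective; inj₂-injective)
open import Data.Unit using (⊤)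
open import Data.Vec using (Vec; []; _∷_; uncons; lookup; tabulate; replicate; _[_]≔_)
open import Data.Vec.Properties
  using (lookup-replicate; lookup∘tabulate; tabulate∘lookup; tabulate-cong;
         lookup∘update; lookup∘update′; []≔-idempotent; []≔-lookup)
open import Function.Bundles using (_↔_; _↣_; Injection; Inverse; Equivalence; mk↣; mk↔ₛ′)
open import Function.Construct.Composition using (_↔-∘_; _↣-∘_)
open import Function.Construct.Identity using (↔-id)
open import Function.Construct.Symmetry using (↔-sym)
open import Function.Definitions using (Injective)
open import Function.Properties.Inverse using (↔⇒↣)
open import Relation.Binary.Definitions using (DecidableEquality; tri<; tri≈; tri>)
open import Relation.Binary.PropositionalEquality
open import Relation.Nullary using (¬_; Dec; yes; no)
open import Relation.Unary using (Decidable)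

open import Defs

private
  variable
    X Y Z : Set
    a b k : ℕ

↣⇒≤ : X ↔ Fin a → Y ↔ Fin b → X ↣ Y → a ≤ b
↣⇒≤ sizeX sizeY f =
  injective⇒≤ (Injection.injective (↔⇒↣ sizeY ↣-∘ (f ↣-∘ ↔⇒↣ (↔-sym sizeX))))

⊤↔Fin : ⊤ ↔ Fin 1
⊤↔Fin = ↔-sym 1↔⊤

×↔Fin : X ↔ Fin a → Y ↔ Fin b → (X × Y) ↔ Fin (a * b)
×↔Fin sizeX sizeY = ↔-sym *↔× ↔-∘ (sizeX ×-↔ sizeY)

⊎↔Fin : X ↔ Fin a → Y ↔ Fin b → (X ⊎ Y) ↔ Fin (a + b)
⊎↔Fin sizeX sizeY = ↔-sym +↔⊎ ↔-∘ (sizeX ⊎-↔ sizeY)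

Vec↔Fin : X ↔ Fin a → ∀ k → Vec X k ↔ Fin (a ^ k)
Vec↔Fin sizeX zero    = mk↔ₛ′ (λ _ → zero) (λ _ → []) (λ { zero → refl }) (λ { [] → refl })
Vec↔Fin sizeX (suc k) = ×↔Fin sizeX (Vec↔Fin sizeX k) ↔-∘ uncons↔
  where
  uncons↔ : Vec _ (suc k) ↔ (_ × Vec _ k)
  uncons↔ = mk↔ₛ′ uncons (uncurry _∷_) (λ _ → refl) (λ { (x ∷ xs) → refl })

↣-disjoint-⊎ : (f : X ↣ Z) (g : Y ↣ Z) →
               (∀ x y → Injection.to f x ≢ Injection.to g y) → (X ⊎ Y) ↣ Z
↣-disjoint-⊎ f g disjoint = mk↣ injective
  where
  to : _ ⊎ _ → _
  to (inj₁ x) = Injection.to f x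
  to (inj₂ y) = Injection.to g y
  injective : Injective _≡_ _≡_ to
  injective {inj₁ x} {inj₁ x′} e = cong inj₁ (Injection.injective f e)
  injective {inj₁ x} {inj₂ y′} e with () ← disjoint x y′ e
  injective {inj₂ y} {inj₁ x′} e with () ← disjoint x′ y (sym e)
  injective {inj₂ y} {inj₂ y′} e = cong inj₂ (Injection.injective g e)

↣-cases : {P : X → Set} → Decidable P →
          (f : ∀ x → P x → Y) → (∀ {x y} p q → f x p ≡ f y q → x ≡ y) →
          (g : ∀ x → ¬ P x → Z) → (∀ {x y} p q → g x p ≡ g y q → x ≡ y) →
          X ↣ (Y ⊎ Z)
↣-cases {P = P} P? f f-inj g g-inj = mk↣ injective
  where
  by : ∀ x → Dec (P x) → _ ⊎ _
  by x (yes p) = inj₁ (f x p)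
  by x (no ¬p) = inj₂ (g x ¬p)
  injective : Injective _≡_ _≡_ (λ x → by x (P? x))
  injective {x} {y} e with P? x | P? y
  ... | yes p | yes q = f-inj p q (inj₁-injective e)
  ... | no ¬p | no ¬q = g-inj ¬p ¬q (inj₂-injective e)

module Card {X : Set} {P : X → Set} {c : ℕ} (card : IsCard P c) where

  member : Fin c → X
  member = proj₁ card

  member-injective : Injective _≡_ _≡_ member
  member-injective = proj₁ (proj₂ card)

  member-satisfies : ∀ i → P (member i)
  member-satisfies i = Equivalence.from (proj₂ (proj₂ card) (member i)) (i , refl)

  index : ∀ {x} → P x → Fin c
  index {x} p = proj₁ (Equivalence.to (proj₂ (proj₂ card) x) p)

  member-index : ∀ {x} (p : P x) → member (index p) ≡ x
  member-index {x} p = proj₂ (Equivalence.to (proj₂ (proj₂ card) x) p)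

  index-injective : ∀ {x y} (p : P x) (q : P y) → index p ≡ index q → x ≡ y
  index-injective p q e = trans (sym (member-index p)) (trans (cong member e) (member-index q))

[]≔-injective : ∀ {xs ys : Vec X k} i {x y} →
                xs [ i ]≔ x ≡ ys [ i ]≔ y → lookup xs i ≡ lookup ys i → xs ≡ ys
[]≔-injective {xs = xs} {ys} i {x} {y} e eᵢ = begin
  xs                                  ≡⟨ []≔-lookup xs i ⟨
  xs [ i ]≔ lookup xs i               ≡⟨ []≔-idempotent xs i ⟨
  (xs [ i ]≔ x) [ i ]≔ lookup xs i    ≡⟨ cong₂ (λ v z → v [ i ]≔ z) e eᵢ ⟩
  (ys [ i ]≔ y) [ i ]≔ lookup ys i    ≡⟨ []≔-idempotent ys i ⟩
  ys [ i ]≔ lookup ys i               ≡⟨ []≔-lookup ys i ⟩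
  ys                                  ∎
  where open ≡-Reasoning

gap : ∀ {a b} → a < b → ∃[ δ ] b ≡ a + suc δ
gap {a} a<b = _ , sym (trans (ℕ.+-suc a _) (ℕ.m+[n∸m]≡n a<b))

dirIndex : Dir → Fin 8
dirIndex N  = 0F
dirIndex NE = 1F
dirIndex E  = 2F
dirIndex SE = 3F
dirIndex S  = 4F
dirIndex SW = 5F
dirIndex W  = 6F
dirIndex NW = 7F

dirAt : Fin 8 → Dir
dirAt 0F = N
dirAt 1F = NE
dirAt 2F = E
dirAt 3F = SE
dirAt 4F = S
dirAt 5F = SW
dirAt 6F = W
dirAt 7F = NW

dirIndex-dirAt : ∀ i → dirIndex (dirAt i) ≡ i
dirIndex-dirAt 0F = refl
dirIndex-dirAt 1F = refl
dirIndex-dirAt 2F = refl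
dirIndex-dirAt 3F = refl
dirIndex-dirAt 4F = refl
dirIndex-dirAt 5F = refl
dirIndex-dirAt 6F = refl
dirIndex-dirAt 7F = refl

dirAt-dirIndex : ∀ d → dirAt (dirIndex d) ≡ d
dirAt-dirIndex N  = refl
dirAt-dirIndex NE = refl
dirAt-dirIndex E  = refl
dirAt-dirIndex SE = refl
dirAt-dirIndex S  = refl
dirAt-dirIndex SW = refl
dirAt-dirIndex W  = refl
dirAt-dirIndex NW = refl

Dir↔Fin : Dir ↔ Fin 8
Dir↔Fin = mk↔ₛ′ dirIndex dirAt dirIndex-dirAt dirAt-dirIndex

_≟ᴰ_ : DecidableEquality Dir
_≟ᴰ_ = inj⇒≟ (↔⇒↣ Dir↔Fin)

avoid : Dir → Fin 7 → Dir
avoid d k = dirAt (punchIn (dirIndex d) k)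

avoid-≢ : ∀ d k → avoid d k ≢ d
avoid-≢ d k e = punchInᵢ≢i (dirIndex d) k (trans (sym (dirIndex-dirAt _)) (cong dirIndex e))

avoid-injective : ∀ d {k k′} → avoid d k ≡ avoid d k′ → k ≡ k′
avoid-injective d {k} {k′} e = punchIn-injective (dirIndex d) k k′
  (trans (sym (dirIndex-dirAt _)) (trans (cong dirIndex e) (dirIndex-dirAt _)))

transposeDir : Dir → Dir
transposeDir N  = W
transposeDir NE = SW
transposeDir E  = S
transposeDir SE = SE
transposeDir S  = E
transposeDir SW = NE
transposeDir W  = N
transposeDir NW = NW

transposeDir-involutive : ∀ d → transposeDir (transposeDir d) ≡ d
transposeDir-involutive N  = refl
transposeDir-involutive NE = refl
transposeDir-involutive E  = refl
transposeDir-involutive SE = refl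
transposeDir-involutive S  = refl
transposeDir-involutive SW = refl
transposeDir-involutive W  = refl
transposeDir-involutive NW = refl

halves : Dir ↔ (Fin 2 × Fin 4)
halves = *↔× ↔-∘ Dir↔Fin

halves-injective : Injective _≡_ _≡_ (Inverse.to halves)
halves-injective = Injection.injective (↔⇒↣ halves)

-- Injectively turns the upper entry of a column away from S (in the middle column an S would
-- give a two-move path); the tag tells whether it was S, and otherwise stores k.
clearSouth : Fin 7 → Dir × Dir → Fin 8 × (Dir × Dir)
clearSouth k (u , l) with u ≟ᴰ S
... | yes _ = fromℕ 7 , avoid S k , l
... | no _  = inject₁ k , u , l

clearSouth-≢S : ∀ k p → proj₁ (proj₂ (clearSouth k p)) ≢ S
clearSouth-≢S k (u , l) with u ≟ᴰ S
... | yes _   = avoid-≢ S k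
... | no u≢S  = u≢S

clearSouth-keeps : ∀ k p → proj₁ p ≢ S → proj₂ (clearSouth k p) ≡ p
clearSouth-keeps k (u , l) u≢S with u ≟ᴰ S
... | yes u≡S = ⊥-elim (u≢S u≡S)
... | no _    = refl

clearSouth-injective : ∀ {k k′ p p′} → clearSouth k p ≡ clearSouth k′ p′ → k ≡ k′ × p ≡ p′
clearSouth-injective {k} {k′} {u , l} {u′ , l′} e with u ≟ᴰ S | u′ ≟ᴰ S
clearSouth-injective e    | no _ | no _ = inject₁-injective (,-injectiveˡ e) , ,-injectiveʳ e
clearSouth-injective e    | yes refl | yes refl =
  avoid-injective S (,-injectiveˡ (,-injectiveʳ e)) , cong (S ,_) (,-injectiveʳ (,-injectiveʳ e))
clearSouth-injective e    | yes _ | no _ = ⊥-elim (fromℕ≢inject₁ (,-injectiveˡ e))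
clearSouth-injective e    | no _ | yes _ = ⊥-elim (fromℕ≢inject₁ (sym (,-injectiveˡ e)))

module _ {n : ℕ} where

  build : (Pos n → Dir) → Board n
  build f = tabulate λ i → tabulate λ j → f (i , j)

  entry-build : ∀ f p → entry (build f) p ≡ f p
  entry-build f (i , j) =
    trans (cong (λ row → lookup row j) (lookup∘tabulate _ i)) (lookup∘tabulate _ j)

  build-entry : ∀ A → build (entry A) ≡ A
  build-entry A = trans (tabulate-cong λ i → tabulate∘lookup (lookup A i)) (tabulate∘lookup A)

  board-ext : ∀ {A B} → (∀ p → entry A p ≡ entry B p) → A ≡ B
  board-ext {A} {B} e = begin
    A                ≡⟨ build-entry A ⟨
    build (entry A)  ≡⟨ tabulate-cong (λ i → tabulate-cong λ j → e (i , j)) ⟩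
    build (entry B)  ≡⟨ build-entry B ⟩
    B                ∎
    where open ≡-Reasoning

Directing-transpose : ∀ {n} d (p q : Pos n) → Directing d p q → Directing (transposeDir d) (swap p) (swap q)
Directing-transpose N  p q (e , δ)          = e , δ
Directing-transpose NE p q (δ , e₁ , e₂)    = δ , e₂ , e₁
Directing-transpose E  p q (e , δ)          = e , δ
Directing-transpose SE p q (δ , e₁ , e₂)    = δ , e₂ , e₁
Directing-transpose S  p q (e , δ)          = e , δ
Directing-transpose SW p q (δ , e₁ , e₂)    = δ , e₂ , e₁
Directing-transpose W  p q (e , δ)          = e , δ
Directing-transpose NW p q (δ , e₁ , e₂)    = δ , e₂ , e₁

module _ {n : ℕ} where

  transpose : Board n → Board n
  transpose A = build λ p → transposeDir (entry A (swap p))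

  entry-transpose : ∀ A p → entry (transpose A) p ≡ transposeDir (entry A (swap p))
  entry-transpose A = entry-build _

  transpose-involutive : ∀ A → transpose (transpose A) ≡ A
  transpose-involutive A = board-ext λ p →
    trans (entry-transpose (transpose A) p) (trans (cong transposeDir (entry-transpose A (swap p))) (transposeDir-involutive _))

  transpose-injective : Injective _≡_ _≡_ transpose
  transpose-injective {A} {B} e =
    trans (sym (transpose-involutive A)) (trans (cong transpose e) (transpose-involutive B))

module _ {h : ℕ} where

  ReachIn-transpose : ∀ {A : Board (suc h)} k {p} → ReachIn A k p → ReachIn (transpose A) k (swap p)
  ReachIn-transpose zero    refl               = refl
  ReachIn-transpose {A} (suc k) {p} (q , r , mv) =
    swap q , ReachIn-transpose k r ,
    subst (λ d → Directing d (swap q) (swap p)) (sym (entry-transpose A (swap q))) (Directing-transpose _ q p mv)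

module _ {h : ℕ} {A : Board (suc (h + h))} where

  HasLength-transpose : ∀ {k} → HasLength h A k → HasLength h (transpose A) k
  HasLength-transpose {k} (reach , minimal) =
    ReachIn-transpose k reach ,
    λ j j<k reach′ → minimal j j<k
      (subst (λ B → ReachIn B j (center h)) (transpose-involutive A) (ReachIn-transpose j reach′))

  HasLength-unique : ∀ {k k′} → HasLength h A k → HasLength h A k′ → k ≡ k′
  HasLength-unique {k} {k′} (reach , minimal) (reach′ , minimal′) with ℕ.<-cmp k k′
  ... | tri< k<k′ _ _ = ⊥-elim (minimal′ k k<k′ reach)
  ... | tri≈ _ k≡k′ _ = k≡k′
  ... | tri> _ _ k′<k = ⊥-elim (minimal k′ k′<k reach′)

-- The boards built in the counting arguments start E, so whether one of them has been
-- transposed (and then starts S) can be read off and stores one bit.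
transposeIf : ∀ {n} → Fin 2 → Board n → Board n
transposeIf 0F B = B
transposeIf 1F B = transpose B

transposed-start : ∀ {n} (B : Board (suc n)) → entry B start ≡ E → entry (transpose B) start ≡ S
transposed-start B startE = trans (entry-transpose B start) (cong transposeDir startE)

module _ {n : ℕ} {B B′ : Board (suc n)} (startE : entry B start ≡ E) (startE′ : entry B′ start ≡ E) where

  transposeIf-injective : ∀ {b b′} → transposeIf b B ≡ transposeIf b′ B′ → b ≡ b′ × B ≡ B′
  transposeIf-injective {0F} {0F} e = refl , e
  transposeIf-injective {1F} {1F} e = refl , transpose-injective e
  transposeIf-injective {0F} {1F} e
    with () ← trans (sym startE) (trans (cong (λ C → entry C start) e) (transposed-start B′ startE′))
  transposeIf-injective {1F} {0F} e
    with () ← trans (sym (transposed-start B startE)) (trans (cong (λ C → entry C start) e) startE′)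

HasLength-transposeIf : ∀ {h k} {B : Board (suc (h + h))} b → HasLength h B k → HasLength h (transposeIf b B) k
HasLength-transposeIf 0F = λ l → l
HasLength-transposeIf 1F = HasLength-transpose

opening : Fin 3 → Dir
opening 0F = E
opening 1F = S
opening 2F = SE

module _ {n : ℕ} where

  setStart : Dir → Board (suc n) → Board (suc n)
  setStart d ((_ ∷ row) ∷ rows) = (d ∷ row) ∷ rows

  entry-setStart : ∀ d A → entry (setStart d A) start ≡ d
  entry-setStart d ((_ ∷ _) ∷ _) = refl

  setStart-injective : ∀ {d} {A B : Board (suc n)} → setStart d A ≡ setStart d B →
                       entry A start ≡ entry B start → A ≡ B
  setStart-injective {A = (_ ∷ _) ∷ _} {(_ ∷ _) ∷ _} refl refl = refl

  Directing-start : ∀ d (q : Pos (suc n)) → Directing d start q → ∃[ o ] opening o ≡ d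
  Directing-start N  q (_ , δ , e)   = ⊥-elim (ℕ.m+1+n≢0 _ (sym e))
  Directing-start NE q (δ , e , _)   = ⊥-elim (ℕ.m+1+n≢0 _ (sym e))
  Directing-start E  q _             = 0F , refl
  Directing-start SE q _             = 2F , refl
  Directing-start S  q _             = 1F , refl
  Directing-start SW q (δ , _ , e)   = ⊥-elim (ℕ.m+1+n≢0 _ (sym e))
  Directing-start W  q (_ , δ , e)   = ⊥-elim (ℕ.m+1+n≢0 _ (sym e))
  Directing-start NW q (δ , e , _)   = ⊥-elim (ℕ.m+1+n≢0 _ (sym e))

  first-move : ∀ {A : Board (suc n)} k {p} → ReachIn A (suc k) p → ∃[ q ] Move A start q
  first-move zero    (q , refl , mv) = _ , mv
  first-move (suc k) (q , reach , _) = first-move k reach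

  stuck : Board (suc n)
  stuck = setStart E (replicate _ (replicate _ SE))

  entry-stuck : ∀ q → toℕ (proj₁ q) < toℕ (proj₂ q) → entry stuck q ≡ SE
  entry-stuck (zero  , suc j) _ = lookup-replicate j SE
  entry-stuck (suc i , j)     _ = trans (cong (λ row → lookup row j) (lookup-replicate i _)) (lookup-replicate j SE)

  reach-stuck : ∀ k {p} → ReachIn stuck k p → p ≡ start ⊎ toℕ (proj₁ p) < toℕ (proj₂ p)
  reach-stuck zero    refl = inj₁ refl
  reach-stuck (suc k) {i , j} (q , reach , mv) with reach-stuck k reach
  ... | inj₁ refl with e , δ , e′ ← mv = inj₂ (subst₂ _<_ (sym e) (sym e′) (s≤s z≤n))
  ... | inj₂ above with δ , e , e′ ← subst (λ d → Directing d q (i , j)) (entry-stuck q above) mv =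
    inj₂ (subst₂ _<_ (sym e) (sym e′) (ℕ.+-monoˡ-< (suc δ) above))

module _ {h s : ℕ} (solvable : IsCard (Solvable h) s) where
  private
    module Sol = Card solvable

  lengthClass-↣ : ∀ {k c} → IsCard (λ A → HasLength h A k) c → Fin c ↣ Fin s
  lengthClass-↣ {k} lengthK = mk↣ λ e →
    L.member-injective (Sol.index-injective (k , proj₁ (L.member-satisfies _)) (k , proj₁ (L.member-satisfies _)) e)
    where module L = Card lengthK

  lengthClass-disjoint : ∀ {k k′ c c′} (lengthK : IsCard (λ A → HasLength h A k) c)
                         (lengthK′ : IsCard (λ A → HasLength h A k′) c′) → k ≢ k′ →
                         ∀ i i′ → Injection.to (lengthClass-↣ lengthK) i ≢ Injection.to (lengthClass-↣ lengthK′) i′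
  lengthClass-disjoint lengthK lengthK′ k≢k′ i i′ e = k≢k′ (HasLength-unique
    (L.member-satisfies i)
    (subst (λ A → HasLength h A _) (sym (Sol.index-injective _ _ e)) (L′.member-satisfies i′)))
    where
    module L = Card lengthK
    module L′ = Card lengthK′

  lengths-bound : ∀ {c₁ c₂ c₃ k c} →
                  IsCard (λ A → HasLength h A 1) c₁ → IsCard (λ A → HasLength h A 2) c₂ →
                  IsCard (λ A → HasLength h A 3) c₃ → 4 ≤ k → IsCard (λ A → HasLength h A k) c →
                  c₁ + c₂ + c₃ + c ≤ s
  lengths-bound length₁ length₂ length₃ 4≤k lengthK =
    ↣⇒≤ (⊎↔Fin (⊎↔Fin (⊎↔Fin (↔-id _) (↔-id _)) (↔-id _)) (↔-id _)) (↔-id _)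
      (↣-disjoint-⊎ (↣-disjoint-⊎ (↣-disjoint-⊎ (lengthClass-↣ length₁) (lengthClass-↣ length₂)
                                                  (lengthClass-disjoint length₁ length₂ λ ()))
                                   (lengthClass-↣ length₃)
                                   λ { (inj₁ i) → lengthClass-disjoint length₁ length₃ (λ ()) i
                                     ; (inj₂ i) → lengthClass-disjoint length₂ length₃ (λ ()) i })
                    (lengthClass-↣ lengthK)
                    λ { (inj₁ (inj₁ i)) → lengthClass-disjoint length₁ lengthK (short (s≤s (s≤s z≤n))) i
                      ; (inj₁ (inj₂ i)) → lengthClass-disjoint length₂ lengthK (short (s≤s (s≤s (s≤s z≤n)))) i
                      ; (inj₂ i)        → lengthClass-disjoint length₃ lengthK (short ℕ.≤-refl) i })
    where
    short : ∀ {j} → j < 4 → j ≢ _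
    short j<4 = ℕ.<⇒≢ (ℕ.<-≤-trans j<4 4≤k)

module OddBoard (h′ : ℕ) where

  h n m : ℕ
  h = suc h′
  n = suc (h + h)
  m = h′ + h      -- n − 2, the exponent suc (h + h) ∸ 2 of the statement

  mid : Fin n
  mid = fromℕ h ↑ˡ h

  midColumn : Fin m
  midColumn = fromℕ< (ℕ.m≤n+m h h′)

  -- Inner column c is board column c + 1, with upper cell (0, c + 1) and lower cell
  -- (h, c + 1); only the middle column c + 1 = h, whose lower cell would be the centre, is
  -- paired with (h, 2h) instead. Coordinates are 0-based, so the centre is (h, h).
  data Slot : Set where
    origin corner : Slot
    upper lower : Fin m → Slot

  lowerColumn : Fin m → Fin n
  lowerColumn c with <-cmp c midColumn
  ... | tri≈ _ _ _ = suc (fromℕ m)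
  ... | _          = suc (inject₁ c)

  lowerColumn-mid : lowerColumn midColumn ≡ suc (fromℕ m)
  lowerColumn-mid with <-cmp midColumn midColumn
  ... | tri< mid<mid _ _ = ⊥-elim (<-irrefl refl mid<mid)
  ... | tri≈ _ _ _       = refl
  ... | tri> _ _ mid<mid = ⊥-elim (<-irrefl refl mid<mid)

  lowerColumn-inner : ∀ {c} → c ≢ midColumn → lowerColumn c ≡ suc (inject₁ c)
  lowerColumn-inner {c} c≢mid with <-cmp c midColumn
  ... | tri< _ _ _     = refl
  ... | tri≈ _ c≡mid _ = ⊥-elim (c≢mid c≡mid)
  ... | tri> _ _ _     = refl

  pos : Slot → Pos n
  pos origin    = start
  pos corner    = zero , suc (fromℕ m)
  pos (upper c) = zero , suc (inject₁ c)
  pos (lower c) = mid , lowerColumn c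

  classifyMiddle : Fin n → Maybe Slot
  classifyMiddle zero = nothing
  classifyMiddle (suc j) with view j
  ... | ‵fromℕ = just (lower midColumn)
  ... | ‵inject₁ c with <-cmp c midColumn
  ...   | tri≈ _ _ _ = nothing
  ...   | _          = just (lower c)

  classify : Pos n → Maybe Slot
  classify (zero , zero) = just origin
  classify (zero , suc j) with view j
  ... | ‵fromℕ     = just corner
  ... | ‵inject₁ c = just (upper c)
  classify (suc i , j) with suc i ≟ mid
  ... | yes _ = classifyMiddle j
  ... | no _  = nothing

  classifyMiddle-inner : ∀ c → c ≢ midColumn → classifyMiddle (suc (inject₁ c)) ≡ just (lower c)
  classifyMiddle-inner c c≢mid rewrite view-inject₁ c with <-cmp c midColumn
  ... | tri< _ _ _     = refl
  ... | tri≈ _ c≡mid _ = ⊥-elim (c≢mid c≡mid)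
  ... | tri> _ _ _     = refl

  classify-pos : ∀ σ → classify (pos σ) ≡ just σ
  classify-pos origin    = refl
  classify-pos corner    rewrite view-fromℕ m = refl
  classify-pos (upper c) rewrite view-inject₁ c = refl
  classify-pos (lower c) with mid ≟ mid
  ... | no mid≢mid = ⊥-elim (mid≢mid refl)
  ... | yes _ with <-cmp c midColumn
  ...   | tri< _ c≢mid _ = classifyMiddle-inner c c≢mid
  ...   | tri≈ _ refl _  rewrite view-fromℕ m = refl
  ...   | tri> _ c≢mid _ = classifyMiddle-inner c c≢mid

  classify-sound : ∀ {q σ} → classify q ≡ just σ → pos σ ≡ q
  classify-sound {zero , zero} refl = refl
  classify-sound {zero , suc j} e with view j
  classify-sound {zero , suc _} refl | ‵fromℕ     = refl
  classify-sound {zero , suc _} refl | ‵inject₁ c = refl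
  classify-sound {suc i , j} e with suc i ≟ mid
  classify-sound {suc i , j} e | yes refl = middle j e
    where
    middle : ∀ j {σ} → classifyMiddle j ≡ just σ → pos σ ≡ (mid , j)
    middle (suc j) e with view j
    middle (suc _) refl | ‵fromℕ = cong (mid ,_) lowerColumn-mid
    middle (suc _) e    | ‵inject₁ c with <-cmp c midColumn
    middle (suc _) refl | ‵inject₁ c | tri< _ c≢mid _ = cong (mid ,_) (lowerColumn-inner c≢mid)
    middle (suc _) refl | ‵inject₁ c | tri> _ c≢mid _ = cong (mid ,_) (lowerColumn-inner c≢mid)

  record Frame : Set where
    constructor frame
    field
      atStart atCorner : Dir
      columns          : Vec (Dir × Dir) m

  frame-cong : ∀ {s s′ z z′ t t′} → s ≡ s′ → z ≡ z′ → t ≡ t′ → frame s z t ≡ frame s′ z′ t′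
  frame-cong refl refl refl = refl

  value : Frame → Slot → Dir
  value F origin    = Frame.atStart F
  value F corner    = Frame.atCorner F
  value F (upper c) = proj₁ (lookup (Frame.columns F) c)
  value F (lower c) = proj₂ (lookup (Frame.columns F) c)

  frameOf : Board n → Frame
  frameOf A = frame (entry A start) (entry A (pos corner))
                    (tabulate λ c → entry A (pos (upper c)) , entry A (pos (lower c)))

  value-frameOf : ∀ A σ → value (frameOf A) σ ≡ entry A (pos σ)
  value-frameOf A origin    = refl
  value-frameOf A corner    = refl
  value-frameOf A (upper c) = cong proj₁ (lookup∘tabulate _ c)
  value-frameOf A (lower c) = cong proj₂ (lookup∘tabulate _ c)

  lookup-columns : ∀ A c → lookup (Frame.columns (frameOf A)) c ≡ (entry A (pos (upper c)) , entry A (pos (lower c)))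
  lookup-columns A = lookup∘tabulate _

  reframe : Frame → Board n → Board n
  reframe F A = build λ q → maybe (value F) (entry A q) (classify q)

  entry-reframe : ∀ F A q → entry (reframe F A) q ≡ maybe (value F) (entry A q) (classify q)
  entry-reframe F A = entry-build (λ q → maybe (value F) (entry A q) (classify q))

  entry-reframe-pos : ∀ F A σ → entry (reframe F A) (pos σ) ≡ value F σ
  entry-reframe-pos F A σ = trans (entry-reframe F A (pos σ)) (cong (maybe (value F) _) (classify-pos σ))

  entry-reframe-off : ∀ F A {q} → classify q ≡ nothing → entry (reframe F A) q ≡ entry A q
  entry-reframe-off F A {q} off = trans (entry-reframe F A q) (cong (maybe (value F) _) off)

  frameOf-reframe : ∀ F A → frameOf (reframe F A) ≡ F
  frameOf-reframe F@(frame _ _ t) A = frame-cong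
    (entry-reframe-pos F A origin)
    (entry-reframe-pos F A corner)
    (trans (tabulate-cong λ c → cong₂ _,_ (entry-reframe-pos F A (upper c)) (entry-reframe-pos F A (lower c)))
           (tabulate∘lookup t))

  frame-ext : ∀ {A B} → frameOf A ≡ frameOf B →
                      (∀ q → classify q ≡ nothing → entry A q ≡ entry B q) → A ≡ B
  frame-ext {A} {B} same off = board-ext λ q → at q (classify q) refl
    where
    at : ∀ q κ → classify q ≡ κ → entry A q ≡ entry B q
    at q nothing  e = off q e
    at q (just σ) e = subst (λ p → entry A p ≡ entry B p) (classify-sound e)
      (trans (sym (value-frameOf A σ)) (trans (cong (λ F → value F σ) same) (value-frameOf B σ)))

  reframe-injective : ∀ F A G B → reframe F A ≡ reframe G B → F ≡ G × (frameOf A ≡ frameOf B → A ≡ B)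
  reframe-injective F A G B e =
    trans (sym (frameOf-reframe F A)) (trans (cong frameOf e) (frameOf-reframe G B)) ,
    λ same → frame-ext same λ q off →
      trans (sym (entry-reframe-off F A off)) (trans (cong (λ C → entry C q) e) (entry-reframe-off G B off))

  toℕ-mid : toℕ mid ≡ h
  toℕ-mid = trans (toℕ-↑ˡ (fromℕ h) h) (toℕ-fromℕ h)

  toℕ-inner : ∀ (c : Fin m) → toℕ (suc (inject₁ c)) ≡ suc (toℕ c)
  toℕ-inner c = cong suc (toℕ-inject₁ c)

  toℕ-midColumn : toℕ midColumn ≡ h′
  toℕ-midColumn = toℕ-fromℕ< (ℕ.m≤n+m h h′)

  toℕ-upper-mid : toℕ (suc (inject₁ midColumn)) ≡ h
  toℕ-upper-mid = trans (toℕ-inner midColumn) (cong suc toℕ-midColumn)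

  toℕ-last : toℕ (suc (fromℕ m)) ≡ h + h
  toℕ-last = cong suc (toℕ-fromℕ m)

  center≢start : center h ≢ start
  center≢start ()

  Directing-start-center : ∀ d → Directing d start (center h) → d ≡ SE
  Directing-start-center N  (_ , _ , ())
  Directing-start-center NE (_ , () , _)
  Directing-start-center E  (e , _)     = ⊥-elim (ℕ.1+n≢0 (trans (sym toℕ-mid) e))
  Directing-start-center SE _           = refl
  Directing-start-center S  (e , _)     = ⊥-elim (ℕ.1+n≢0 (trans (sym toℕ-mid) e))
  Directing-start-center SW (_ , _ , ())
  Directing-start-center W  (e , _)     = ⊥-elim (ℕ.1+n≢0 (trans (sym toℕ-mid) e))
  Directing-start-center NW (_ , () , _)

  move : ∀ (B : Board n) {p q d} → entry B p ≡ d → Directing d p q → Move B p q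
  move B {p} {q} e = subst (λ d → Directing d p q) (sym e)

  path₃ : ∀ (B : Board n) {p q r} → Move B start p → Move B p q → Move B q r → ReachIn B 3 r
  path₃ B mv₁ mv₂ mv₃ = _ , (_ , (_ , refl , mv₁) , mv₂) , mv₃

  SE⇒length₁ : ∀ {A} → entry A start ≡ SE → HasLength h A 1
  SE⇒length₁ {A} e = (start , refl , move A e (h′ , toℕ-mid , toℕ-mid)) ,
                 λ { zero _ → center≢start ; (suc j) (s≤s ()) }

  length₁⇒SE : ∀ {A} → HasLength h A 1 → entry A start ≡ SE
  length₁⇒SE ((_ , refl , mv) , _) = Directing-start-center _ mv

  solvable⇒opening : ∀ {A} → Solvable h A → ∃[ o ] opening o ≡ entry A start
  solvable⇒opening (zero  , reach) = ⊥-elim (center≢start reach)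
  solvable⇒opening (suc k , reach) = Directing-start _ _ (proj₂ (first-move k reach))

  event : Fin m → Dir × Dir
  event c with <-cmp c midColumn
  ... | tri< _ _ _ = S , E
  ... | tri≈ _ _ _ = SE , W
  ... | tri> _ _ _ = S , W

  event-mid : event midColumn ≡ (SE , W)
  event-mid with <-cmp midColumn midColumn
  ... | tri< mid<mid _ _ = ⊥-elim (<-irrefl refl mid<mid)
  ... | tri≈ _ _ _       = refl
  ... | tri> _ _ mid<mid = ⊥-elim (<-irrefl refl mid<mid)

  top-row-to-center : ∀ d b → toℕ b ≢ 0 → Directing d (zero , b) (center h) →
                      (d ≡ S × (zero , b) ≡ pos (upper midColumn)) ⊎ (d ≡ SW × (zero , b) ≡ pos corner)
  top-row-to-center N  b _ (_ , _ , ())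
  top-row-to-center NE b _ (_ , () , _)
  top-row-to-center E  b _ (e , _) = ⊥-elim (ℕ.1+n≢0 (trans (sym toℕ-mid) e))
  top-row-to-center SE b b≢0 (_ , e , e′) =
    ⊥-elim (b≢0 (ℕ.+-cancelʳ-≡ (suc _) (toℕ b) 0 (trans (sym e′) e)))
  top-row-to-center S  b _ (e , _) =
    inj₁ (refl , cong (zero ,_) (toℕ-injective (trans (sym e) (trans toℕ-mid (sym toℕ-upper-mid)))))
  top-row-to-center SW b _ (_ , e , e′) =
    inj₂ (refl , cong (zero ,_) (toℕ-injective
      (trans e′ (trans (cong₂ _+_ toℕ-mid (trans (sym e) toℕ-mid)) (sym toℕ-last)))))
  top-row-to-center W  b _ (e , _) = ⊥-elim (ℕ.1+n≢0 (trans (sym toℕ-mid) e))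
  top-row-to-center NW b _ (_ , () , _)

  module StartEast (B : Board n) (startE : entry B start ≡ E) where

    first-move-E : ∀ {q} → Move B start q → ∃[ b ] q ≡ (zero , b) × toℕ b ≢ 0
    first-move-E {i , j} mv with subst (λ d → Directing d start (i , j)) startE mv
    ... | e , _ , e′ = j , cong (_, j) (toℕ-injective e) , λ j≡0 → ℕ.1+n≢0 (trans (sym e′) j≡0)

    to-upper : ∀ c → Move B start (pos (upper c))
    to-upper c = move B startE (refl , toℕ c , toℕ-inner c)

    to-corner : Move B start (pos corner)
    to-corner = move B startE (refl , m , cong suc (toℕ-fromℕ m))

    not-reach-short : ∀ j → j < 2 → ¬ ReachIn B j (center h)
    not-reach-short zero          _ = center≢start
    not-reach-short (suc zero)    _ ((_ , refl , mv)) with () ← trans (sym startE) (Directing-start-center _ mv)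
    not-reach-short (suc (suc j)) (s≤s (s≤s ()))

    not-reach₂ : entry B (pos (upper midColumn)) ≢ S → entry B (pos corner) ≢ SW → ¬ ReachIn B 2 (center h)
    not-reach₂ ¬S ¬SW (q , (_ , refl , mv₁) , mv₂) with first-move-E mv₁
    ... | b , refl , b≢0 with top-row-to-center _ b b≢0 mv₂
    ...   | inj₁ (isS , at)  = ¬S (trans (cong (entry B) (sym at)) isS)
    ...   | inj₂ (isSW , at) = ¬SW (trans (cong (entry B) (sym at)) isSW)

    length₂ : entry B (pos (upper midColumn)) ≡ S ⊎ entry B (pos corner) ≡ SW → HasLength h B 2
    length₂ hit = reach hit , not-reach-short
      where
      reach : entry B (pos (upper midColumn)) ≡ S ⊎ entry B (pos corner) ≡ SW → ReachIn B 2 (center h)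
      reach (inj₁ isS)  = _ , (_ , refl , to-upper midColumn) ,
                          move B isS (trans toℕ-mid (sym toℕ-upper-mid) , h′ , toℕ-mid)
      reach (inj₂ isSW) = _ , (_ , refl , to-corner) ,
                          move B isSW (h′ , toℕ-mid , trans toℕ-last (cong (_+ h) (sym toℕ-mid)))

    length₃ : entry B (pos (upper midColumn)) ≢ S → entry B (pos corner) ≢ SW →
              ReachIn B 3 (center h) → HasLength h B 3
    length₃ ¬S ¬SW reach = reach , shorter
      where
      shorter : ∀ j → j < 3 → ¬ ReachIn B j (center h)
      shorter zero                _ = not-reach-short 0 (s≤s z≤n)
      shorter (suc zero)          _ = not-reach-short 1 (s≤s (s≤s z≤n))
      shorter (suc (suc zero))    _ = not-reach₂ ¬S ¬SW
      shorter (suc (suc (suc _))) (s≤s (s≤s (s≤s ())))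

    reach-event : ∀ c → (entry B (pos (upper c)) , entry B (pos (lower c))) ≡ event c → ReachIn B 3 (center h)
    reach-event c e with <-cmp c midColumn
    ... | tri< c<mid _ _ =
      path₃ B (to-upper c) (move B (,-injectiveˡ e) (refl , h′ , toℕ-mid)) (move B (,-injectiveʳ e) (refl , east))
      where
      east : ∃[ δ ] toℕ mid ≡ toℕ (suc (inject₁ c)) + suc δ
      east with δ , eq ← gap (s≤s (subst (toℕ c <_) toℕ-midColumn c<mid)) =
        δ , trans toℕ-mid (trans eq (cong (_+ suc δ) (sym (toℕ-inner c))))
    ... | tri≈ _ refl _ =
      path₃ B (to-upper c)
            (move B (,-injectiveˡ e) (h′ , toℕ-mid , trans toℕ-last (cong (_+ h) (sym toℕ-upper-mid))))
            (move B (,-injectiveʳ e) (refl , h′ , trans toℕ-last (cong (_+ h) (sym toℕ-mid))))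
    ... | tri> _ _ mid<c =
      path₃ B (to-upper c) (move B (,-injectiveˡ e) (refl , h′ , toℕ-mid)) (move B (,-injectiveʳ e) (refl , west))
      where
      west : ∃[ δ ] toℕ (suc (inject₁ c)) ≡ toℕ mid + suc δ
      west with δ , eq ← gap (subst (_< toℕ c) toℕ-midColumn mid<c) =
        δ , trans (toℕ-inner c) (trans (cong suc eq) (cong (_+ suc δ) (sym toℕ-mid)))

  stuck-unsolvable : ¬ Solvable h stuck
  stuck-unsolvable (k , reach) with reach-stuck k reach
  ... | inj₁ center≡start = center≢start center≡start
  ... | inj₂ mid<mid      = ℕ.<-irrefl refl mid<mid

  solvable-bound : ∀ {s c₁} → IsCard (Solvable h) s → IsCard (λ A → HasLength h A 1) c₁ → s < 3 * c₁
  solvable-bound {s} {c₁} solvable length₁ =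
    ↣⇒≤ (⊎↔Fin ⊤↔Fin (↔-id _)) (×↔Fin (↔-id _) (↔-id _)) (mk↣ code-injective)
    where
    module Sol = Card solvable
    module L₁ = Card length₁

    board : ⊤ ⊎ Fin s → Board n
    board (inj₁ _) = stuck
    board (inj₂ i) = Sol.member i

    board-injective : Injective _≡_ _≡_ board
    board-injective {inj₁ _} {inj₁ _} _ = refl
    board-injective {inj₂ i} {inj₂ j} e = cong inj₂ (Sol.member-injective e)
    board-injective {inj₁ _} {inj₂ j} e = ⊥-elim (stuck-unsolvable (subst (Solvable h) (sym e) (Sol.member-satisfies j)))
    board-injective {inj₂ i} {inj₁ _} e = ⊥-elim (stuck-unsolvable (subst (Solvable h) e (Sol.member-satisfies i)))

    openingOf : ∀ x → ∃[ o ] opening o ≡ entry (board x) start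
    openingOf (inj₁ _) = 0F , refl
    openingOf (inj₂ i) = solvable⇒opening (Sol.member-satisfies i)

    code : ⊤ ⊎ Fin s → Fin 3 × Fin c₁
    code x = proj₁ (openingOf x) , L₁.index (SE⇒length₁ (entry-setStart SE (board x)))

    code-injective : Injective _≡_ _≡_ code
    code-injective {x} {y} e = board-injective (setStart-injective
      (L₁.index-injective _ _ (,-injectiveʳ e))
      (trans (sym (proj₂ (openingOf x))) (trans (cong opening (,-injectiveˡ e)) (proj₂ (openingOf y)))))

  hit : Dir ⊎ Fin 7 → Dir × Dir
  hit (inj₁ z) = S , z
  hit (inj₂ k) = avoid S k , SW

  hit-injective : Injective _≡_ _≡_ hit
  hit-injective {inj₁ _} {inj₁ _} e = cong inj₁ (,-injectiveʳ e)
  hit-injective {inj₂ _} {inj₂ _} e = cong inj₂ (avoid-injective S (,-injectiveˡ e))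
  hit-injective {inj₁ _} {inj₂ k} e = ⊥-elim (avoid-≢ S k (sym (,-injectiveˡ e)))
  hit-injective {inj₂ k} {inj₁ _} e = ⊥-elim (avoid-≢ S k (,-injectiveˡ e))

  hit-hits : ∀ x → proj₁ (hit x) ≡ S ⊎ proj₂ (hit x) ≡ SW
  hit-hits (inj₁ _) = inj₁ refl
  hit-hits (inj₂ _) = inj₂ refl

  shortcut : Dir × Dir → Board n → Frame
  shortcut (u , z) A =
    frame E z (Frame.columns (frameOf A) [ midColumn ]≔ (u , entry A (pos (lower midColumn))))

  shortcut-mid : ∀ p A →
                 lookup (Frame.columns (shortcut p A)) midColumn ≡ (proj₁ p , entry A (pos (lower midColumn)))
  shortcut-mid p A = lookup∘update midColumn (Frame.columns (frameOf A)) _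

  module _ {c₁ c₂ : ℕ} (length₁ : IsCard (λ A → HasLength h A 1) c₁)
                       (length₂ : IsCard (λ A → HasLength h A 2) c₂) where
    private
      module L₁ = Card length₁
      module L₂ = Card length₂

      frameFor : Dir ⊎ Fin 7 → Fin c₁ → Frame
      frameFor x i = shortcut (hit x) (L₁.member i)

      board : Dir ⊎ Fin 7 → Fin c₁ → Board n
      board x i = reframe (frameFor x i) (L₁.member i)

      upperHalves : Fin c₁ → Fin 2 × Fin 4
      upperHalves i = Inverse.to halves (entry (L₁.member i) (pos (upper midColumn)))

      board-startE : ∀ x i → entry (board x i) start ≡ E
      board-startE x i = entry-reframe-pos (frameFor x i) (L₁.member i) origin

      board-length₂ : ∀ x i → HasLength h (board x i) 2
      board-length₂ x i = StartEast.length₂ (board x i) (board-startE x i) (reached (hit-hits x))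
        where
        at : ∀ σ → entry (board x i) (pos σ) ≡ value (frameFor x i) σ
        at = entry-reframe-pos (frameFor x i) (L₁.member i)
        reached : proj₁ (hit x) ≡ S ⊎ proj₂ (hit x) ≡ SW →
                  entry (board x i) (pos (upper midColumn)) ≡ S ⊎ entry (board x i) (pos corner) ≡ SW
        reached (inj₁ isS)  = inj₁ (trans (at (upper midColumn)) (trans (cong proj₁ (shortcut-mid (hit x) (L₁.member i))) isS))
        reached (inj₂ isSW) = inj₂ (trans (at corner) isSW)

      code : (Dir ⊎ Fin 7) × Fin c₁ → (Fin 4 × Dir) × Fin c₂
      code (x , i) = (proj₂ (upperHalves i) , entry (L₁.member i) (pos corner)) ,
                     L₂.index (HasLength-transposeIf (proj₁ (upperHalves i)) (board-length₂ x i))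

      code-injective : Injective _≡_ _≡_ code
      code-injective {x , i} {x′ , i′} e = cong₂ _,_ (hit-injective (cong₂ _,_ (,-injectiveˡ pairs≡) corner≡)) i≡i′
        where
        A A′ : Board n
        A = L₁.member i
        A′ = L₁.member i′
        boards≡ : proj₁ (upperHalves i) ≡ proj₁ (upperHalves i′) × board x i ≡ board x′ i′
        boards≡ = transposeIf-injective (board-startE x i) (board-startE x′ i′) (L₂.index-injective _ _ (,-injectiveʳ e))
        frames≡ : frameFor x i ≡ frameFor x′ i′ × (frameOf A ≡ frameOf A′ → A ≡ A′)
        frames≡ = reframe-injective (frameFor x i) A (frameFor x′ i′) A′ (proj₂ boards≡)
        corner≡ : proj₂ (hit x) ≡ proj₂ (hit x′)
        corner≡ = cong Frame.atCorner (proj₁ frames≡)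
        columns≡ : Frame.columns (frameFor x i) ≡ Frame.columns (frameFor x′ i′)
        columns≡ = cong Frame.columns (proj₁ frames≡)
        pairs≡ : (proj₁ (hit x) , entry A (pos (lower midColumn))) ≡ (proj₁ (hit x′) , entry A′ (pos (lower midColumn)))
        pairs≡ = trans (sym (shortcut-mid (hit x) A))
                       (trans (cong (λ t → lookup t midColumn) columns≡) (shortcut-mid (hit x′) A′))
        upper≡ : entry A (pos (upper midColumn)) ≡ entry A′ (pos (upper midColumn))
        upper≡ = halves-injective (cong₂ _,_ (proj₁ boards≡) (,-injectiveˡ (,-injectiveˡ e)))
        midPair≡ : lookup (Frame.columns (frameOf A)) midColumn ≡ lookup (Frame.columns (frameOf A′)) midColumn
        midPair≡ = trans (lookup-columns A midColumn)
                         (trans (cong₂ _,_ upper≡ (,-injectiveʳ pairs≡)) (sym (lookup-columns A′ midColumn)))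
        i≡i′ : i ≡ i′
        i≡i′ = L₁.member-injective (proj₂ frames≡ (frame-cong
          (trans (length₁⇒SE (L₁.member-satisfies i)) (sym (length₁⇒SE (L₁.member-satisfies i′))))
          (,-injectiveʳ (,-injectiveˡ e))
          ([]≔-injective midColumn columns≡ midPair≡)))

    length₂-count : 15 * c₁ ≤ 32 * c₂
    length₂-count =
      ↣⇒≤ (×↔Fin (⊎↔Fin Dir↔Fin (↔-id _)) (↔-id _)) (×↔Fin (×↔Fin (↔-id _) Dir↔Fin) (↔-id _))
          (mk↣ code-injective)

  Event : Vec (Dir × Dir) m → Set
  Event t = ∃[ c ] lookup t c ≡ event c

  event? : ∀ t → Dec (Event t)
  event? t = any? λ c → ≡-dec _≟ᴰ_ _≟ᴰ_ (lookup t c) (event c)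

  pairIndex : Dir × Dir → Fin 64
  pairIndex = Inverse.to (×↔Fin Dir↔Fin Dir↔Fin)

  pairIndex-injective : Injective _≡_ _≡_ pairIndex
  pairIndex-injective = Injection.injective (↔⇒↣ (×↔Fin Dir↔Fin Dir↔Fin))

  avoidEvents : ∀ t → ¬ Event t → Vec (Fin 63) m
  avoidEvents t none = tabulate (avoidEvent t none)
    where
    avoidEvent : ∀ t → ¬ Event t → Fin m → Fin 63
    avoidEvent t none c = punchOut {i = pairIndex (event c)} λ e → none (c , sym (pairIndex-injective e))

  avoidEvents-injective : ∀ {t t′} none none′ → avoidEvents t none ≡ avoidEvents t′ none′ → t ≡ t′
  avoidEvents-injective {t} {t′} none none′ e =
    trans (sym (tabulate∘lookup t)) (trans (tabulate-cong same) (tabulate∘lookup t′))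
    where
    same : ∀ c → lookup t c ≡ lookup t′ c
    same c = pairIndex-injective (punchOut-injective {i = pairIndex (event c)} _ _
      (trans (sym (lookup∘tabulate _ c)) (trans (cong (λ v → lookup v c) e) (lookup∘tabulate _ c))))

  eventFrame : Fin 7 × Fin 7 → Vec (Dir × Dir) m → Frame
  eventFrame (kᵤ , k꜀) t = frame E (avoid SW k꜀) (t [ midColumn ]≔ proj₂ (clearSouth kᵤ (lookup t midColumn)))

  eventFrame-mid : ∀ k t →
                   lookup (Frame.columns (eventFrame k t)) midColumn ≡ proj₂ (clearSouth (proj₁ k) (lookup t midColumn))
  eventFrame-mid k t = lookup∘update midColumn t _

  eventFrame-event : ∀ k t → Event t → Event (Frame.columns (eventFrame k t))
  eventFrame-event (kᵤ , k꜀) t (c , e) with c ≟ midColumn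
  ... | yes refl = c , trans (eventFrame-mid (kᵤ , k꜀) t) (trans (clearSouth-keeps kᵤ _ ¬S) e)
    where
    ¬S : proj₁ (lookup t midColumn) ≢ S
    ¬S isS with () ← trans (sym isS) (cong proj₁ (trans e event-mid))
  ... | no c≢mid = c , trans (lookup∘update′ c≢mid t _) e

  module _ {c₁ c₃ : ℕ} (length₁ : IsCard (λ A → HasLength h A 1) c₁)
                       (length₃ : IsCard (λ A → HasLength h A 3) c₃) where
    private
      module L₁ = Card length₁
      module L₃ = Card length₃
      pairs : (Dir × Dir) ↔ Fin 64
      pairs = ×↔Fin Dir↔Fin Dir↔Fin

      Input : Set
      Input = ((Fin 7 × Fin 7) × Vec (Dir × Dir) m) × Fin c₁

      frameFor : Input → Frame
      frameFor ((k , t) , _) = eventFrame k t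

      board : Input → Board n
      board x = reframe (frameFor x) (L₁.member (proj₂ x))

      cornerHalves : Fin c₁ → Fin 2 × Fin 4
      cornerHalves i = Inverse.to halves (entry (L₁.member i) (pos corner))

      board-startE : ∀ x → entry (board x) start ≡ E
      board-startE x = entry-reframe-pos (frameFor x) (L₁.member (proj₂ x)) origin

      board-length₃ : ∀ x → Event (proj₂ (proj₁ x)) → HasLength h (board x) 3
      board-length₃ x@(((kᵤ , k꜀) , t) , i) ev with c , e ← eventFrame-event (kᵤ , k꜀) t ev =
        StartEast.length₃ (board x) (board-startE x)
          (λ isS → clearSouth-≢S kᵤ (lookup t midColumn)
                     (trans (sym (trans (at (upper midColumn)) (cong proj₁ (eventFrame-mid (kᵤ , k꜀) t)))) isS))
          (λ isSW → avoid-≢ SW k꜀ (trans (sym (at corner)) isSW))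
          (StartEast.reach-event (board x) (board-startE x) c (trans (cong₂ _,_ (at (upper c)) (at (lower c))) e))
        where
        at : ∀ σ → entry (board x) (pos σ) ≡ value (frameFor x) σ
        at = entry-reframe-pos (frameFor x) (L₁.member i)

      withEvent : ∀ (x : Input) → Event (proj₂ (proj₁ x)) → ((Fin 8 × Fin 4) × Vec (Dir × Dir) m) × Fin c₃
      withEvent x@(((kᵤ , _) , t) , i) ev =
        ((proj₁ (clearSouth kᵤ (lookup t midColumn)) , proj₂ (cornerHalves i)) , Frame.columns (frameOf (L₁.member i))) ,
        L₃.index (HasLength-transposeIf (proj₁ (cornerHalves i)) (board-length₃ x ev))

      withEvent-injective : ∀ {x y : Input} p q → withEvent x p ≡ withEvent y q → x ≡ y
      withEvent-injective {x@(((kᵤ , k꜀) , t) , i)} {y@(((kᵤ′ , k꜀′) , t′) , i′)} p q e =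
        cong₂ _,_ (cong₂ _,_ (cong₂ _,_ (proj₁ cleared≡) k꜀≡) t≡) i≡
        where
        A A′ : Board n
        A = L₁.member i
        A′ = L₁.member i′
        boards≡ : proj₁ (cornerHalves i) ≡ proj₁ (cornerHalves i′) × board x ≡ board y
        boards≡ = transposeIf-injective (board-startE x) (board-startE y) (L₃.index-injective _ _ (,-injectiveʳ e))
        frames≡ : frameFor x ≡ frameFor y × (frameOf A ≡ frameOf A′ → A ≡ A′)
        frames≡ = reframe-injective (frameFor x) A (frameFor y) A′ (proj₂ boards≡)
        k꜀≡ : k꜀ ≡ k꜀′
        k꜀≡ = avoid-injective SW (cong Frame.atCorner (proj₁ frames≡))
        columns≡ : Frame.columns (frameFor x) ≡ Frame.columns (frameFor y)
        columns≡ = cong Frame.columns (proj₁ frames≡)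
        cleared≡ : kᵤ ≡ kᵤ′ × lookup t midColumn ≡ lookup t′ midColumn
        cleared≡ = clearSouth-injective (cong₂ _,_ (,-injectiveˡ (,-injectiveˡ (,-injectiveˡ e)))
          (trans (sym (eventFrame-mid (kᵤ , k꜀) t))
                 (trans (cong (λ v → lookup v midColumn) columns≡) (eventFrame-mid (kᵤ′ , k꜀′) t′))))
        t≡ : t ≡ t′
        t≡ = []≔-injective midColumn columns≡ (proj₂ cleared≡)
        corner≡ : entry A (pos corner) ≡ entry A′ (pos corner)
        corner≡ = halves-injective (cong₂ _,_ (proj₁ boards≡) (,-injectiveʳ (,-injectiveˡ (,-injectiveˡ e))))
        i≡ : i ≡ i′
        i≡ = L₁.member-injective (proj₂ frames≡ (frame-cong
          (trans (length₁⇒SE (L₁.member-satisfies i)) (sym (length₁⇒SE (L₁.member-satisfies i′))))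
          corner≡
          (,-injectiveʳ (,-injectiveˡ e))))

      withoutEvent : ∀ (x : Input) → ¬ Event (proj₂ (proj₁ x)) → ((Fin 7 × Fin 7) × Vec (Fin 63) m) × Fin c₁
      withoutEvent ((k , t) , i) none = (k , avoidEvents t none) , i

      withoutEvent-injective : ∀ {x y : Input} p q → withoutEvent x p ≡ withoutEvent y q → x ≡ y
      withoutEvent-injective {(k , t) , i} {(k′ , t′) , i′} p q e =
        cong₂ _,_ (cong₂ _,_ (,-injectiveˡ (,-injectiveˡ e)) (avoidEvents-injective p q (,-injectiveʳ (,-injectiveˡ e))))
                  (,-injectiveʳ e)

    length₃-count : 49 * 64 ^ m * c₁ ≤ 32 * 64 ^ m * c₃ + 49 * 63 ^ m * c₁
    length₃-count =
      ↣⇒≤ (×↔Fin (×↔Fin (×↔Fin (↔-id _) (↔-id _)) (Vec↔Fin pairs m)) (↔-id _))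
          (⊎↔Fin (×↔Fin (×↔Fin (×↔Fin (↔-id _) (↔-id _)) (Vec↔Fin pairs m)) (↔-id _))
                 (×↔Fin (×↔Fin (×↔Fin (↔-id _) (↔-id _)) (Vec↔Fin (↔-id _) m)) (↔-id _)))
          (↣-cases (λ x → event? (proj₂ (proj₁ x))) withEvent withEvent-injective withoutEvent withoutEvent-injective)

module _ where
  open +-*-Solver
  open ℕ.≤-Reasoning

  rearrangement-< : ∀ P Q s t → Q < P → s < t → P * s + Q * t < P * t + Q * s
  rearrangement-< P Q s t Q<P s<t =
    subst (λ t → P * s + Q * t < P * t + Q * s) (ℕ.m+[n∸m]≡n s<t) (shifted (t ∸ suc s))
    where
    shifted : ∀ e → P * s + Q * (suc s + e) < P * (suc s + e) + Q * s
    shifted e = begin-strict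
      P * s + Q * (suc s + e)
        ≡⟨ solve 4 (λ P Q s e → P :* s :+ Q :* (con 1 :+ s :+ e)
                              := (P :* s :+ Q :* s) :+ Q :* (con 1 :+ e)) refl P Q s e ⟩
      (P * s + Q * s) + Q * suc e
        <⟨ ℕ.+-monoʳ-< (P * s + Q * s) (ℕ.*-monoˡ-< (suc e) Q<P) ⟩
      (P * s + Q * s) + P * suc e
        ≡⟨ solve 4 (λ P Q s e → (P :* s :+ Q :* s) :+ P :* (con 1 :+ e)
                              := P :* (con 1 :+ s :+ e) :+ Q :* s) refl P Q s e ⟩
      P * (suc s + e) + Q * s ∎

  length₂-bound : ∀ s c₁ c₂ → s < 3 * c₁ → 15 * c₁ ≤ 32 * c₂ → 5 * s < 32 * c₂
  length₂-bound s c₁ c₂ s<3c₁ count = begin-strict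
    5 * s         <⟨ ℕ.*-monoʳ-< 5 s<3c₁ ⟩
    5 * (3 * c₁)  ≡⟨ ℕ.*-assoc 5 3 c₁ ⟨
    15 * c₁       ≤⟨ count ⟩
    32 * c₂       ∎

  length₃-bound : ∀ P Q s c₁ c₃ → Q < P → s < 3 * c₁ →
                  49 * P * c₁ ≤ 32 * P * c₃ + 49 * Q * c₁ →
                  49 * P * s < 96 * P * c₃ + 49 * Q * s
  length₃-bound P Q s c₁ c₃ Q<P s<3c₁ count = ℕ.+-cancelʳ-< (49 * Q * (3 * c₁)) _ _ (begin-strict
    49 * P * s + 49 * Q * (3 * c₁)
      ≡⟨ solve 4 (λ P Q s c₁ → con 49 :* P :* s :+ con 49 :* Q :* (con 3 :* c₁)
                             := con 49 :* (P :* s :+ Q :* (con 3 :* c₁))) refl P Q s c₁ ⟩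
    49 * (P * s + Q * (3 * c₁))
      <⟨ ℕ.*-monoʳ-< 49 (rearrangement-< P Q s (3 * c₁) Q<P s<3c₁) ⟩
    49 * (P * (3 * c₁) + Q * s)
      ≡⟨ solve 4 (λ P Q s c₁ → con 49 :* (P :* (con 3 :* c₁) :+ Q :* s)
                             := con 3 :* (con 49 :* P :* c₁) :+ con 49 :* Q :* s) refl P Q s c₁ ⟩
    3 * (49 * P * c₁) + 49 * Q * s
      ≤⟨ ℕ.+-monoˡ-≤ (49 * Q * s) (ℕ.*-monoʳ-≤ 3 count) ⟩
    3 * (32 * P * c₃ + 49 * Q * c₁) + 49 * Q * s
      ≡⟨ solve 5 (λ P Q s c₁ c₃ → con 3 :* (con 32 :* P :* c₃ :+ con 49 :* Q :* c₁) :+ con 49 :* Q :* s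
                                := con 96 :* P :* c₃ :+ con 49 :* Q :* s :+ con 49 :* Q :* (con 3 :* c₁))
                 refl P Q s c₁ c₃ ⟩
    96 * P * c₃ + 49 * Q * s + 49 * Q * (3 * c₁) ∎)

  longer-bound : ∀ P Q s c₁ c₂ c₃ c → 0 < P → s < 3 * c₁ → 5 * s < 32 * c₂ →
                 49 * P * s < 96 * P * c₃ + 49 * Q * s → c₁ + c₂ + c₃ + c ≤ s →
                 96 * P * c < 49 * Q * s
  longer-bound P Q s c₁ c₂ c₃ c 0<P s<3c₁ 5s<32c₂ bound₃ total = ℕ.+-cancelˡ-< shorter _ _ (begin-strict
    shorter + 96 * P * c
      ≡⟨ solve 5 (λ P c₁ c₂ c₃ c → con 96 :* P :* c₁ :+ con 96 :* P :* c₂ :+ con 96 :* P :* c₃ :+ con 96 :* P :* c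
                                 := con 96 :* P :* (c₁ :+ c₂ :+ c₃ :+ c)) refl P c₁ c₂ c₃ c ⟩
    96 * P * (c₁ + c₂ + c₃ + c)
      ≤⟨ ℕ.*-monoʳ-≤ (96 * P) total ⟩
    96 * P * s
      ≡⟨ solve 2 (λ P s → con 96 :* P :* s
                        := con 32 :* P :* s :+ (con 3 :* P :* (con 5 :* s) :+ con 49 :* P :* s)) refl P s ⟩
    32 * P * s + (3 * P * (5 * s) + 49 * P * s)
      <⟨ ℕ.+-mono-< bound₁ (ℕ.+-mono-≤-< bound₂ bound₃) ⟩
    32 * P * (3 * c₁) + (3 * P * (32 * c₂) + (96 * P * c₃ + 49 * Q * s))
      ≡⟨ solve 6 (λ P Q s c₁ c₂ c₃ →
                    con 32 :* P :* (con 3 :* c₁) :+ (con 3 :* P :* (con 32 :* c₂) :+ (con 96 :* P :* c₃ :+ con 49 :* Q :* s))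
                    := con 96 :* P :* c₁ :+ con 96 :* P :* c₂ :+ con 96 :* P :* c₃ :+ con 49 :* Q :* s)
                 refl P Q s c₁ c₂ c₃ ⟩
    shorter + 49 * Q * s ∎)
    where
    shorter : ℕ
    shorter = 96 * P * c₁ + 96 * P * c₂ + 96 * P * c₃
    bound₁ : 32 * P * s < 32 * P * (3 * c₁)
    bound₁ = ℕ.*-monoʳ-< (32 * P) {{>-nonZero (ℕ.*-monoʳ-< 32 0<P)}} s<3c₁
    bound₂ : 3 * P * (5 * s) ≤ 3 * P * (32 * c₂)
    bound₂ = ℕ.*-monoʳ-≤ (3 * P) (ℕ.<⇒≤ 5s<32c₂)

lemma3p1 : (h : ℕ) → 1 ≤ h →
           (s c₁ c₂ c₃ : ℕ) →
           IsCard (Solvable h) s →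
           IsCard (λ A → HasLength h A 1) c₁ →
           IsCard (λ A → HasLength h A 2) c₂ →
           IsCard (λ A → HasLength h A 3) c₃ →
             (s < 3 * c₁)
           × (5 * s < 32 * c₂)
           × (49 * 64 ^ (suc (h + h) ∸ 2) * s < 96 * 64 ^ (suc (h + h) ∸ 2) * c₃ + 49 * 63 ^ (suc (h + h) ∸ 2) * s)
           × ((k c : ℕ) → 4 ≤ k → IsCard (λ A → HasLength h A k) c →
                96 * 64 ^ (suc (h + h) ∸ 2) * c < 49 * 63 ^ (suc (h + h) ∸ 2) * s)
lemma3p1 (suc h′) _ s c₁ c₂ c₃ solvable length₁ length₂ length₃ = bound₁ , bound₂ , bound₃ , bound₄
  where
  open OddBoard h′
  63^m<64^m : 63 ^ m < 64 ^ m
  63^m<64^m = subst (λ e → 63 ^ e < 64 ^ e) (sym (ℕ.+-suc h′ h′)) (ℕ.^-monoˡ-< (suc (h′ + h′)) (ℕ.n<1+n 63))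

  bound₁ : s < 3 * c₁
  bound₁ = solvable-bound solvable length₁

  bound₂ : 5 * s < 32 * c₂
  bound₂ = length₂-bound s c₁ c₂ bound₁ (length₂-count length₁ length₂)

  bound₃ : 49 * 64 ^ m * s < 96 * 64 ^ m * c₃ + 49 * 63 ^ m * s
  bound₃ = length₃-bound (64 ^ m) (63 ^ m) s c₁ c₃ 63^m<64^m bound₁ (length₃-count length₁ length₃)

  bound₄ : (k c : ℕ) → 4 ≤ k → IsCard (λ A → HasLength h A k) c → 96 * 64 ^ m * c < 49 * 63 ^ m * s
  bound₄ k c 4≤k lengthK = longer-bound (64 ^ m) (63 ^ m) s c₁ c₂ c₃ c (ℕ.m^n>0 64 m) bound₁ bound₂ bound₃
    (lengths-bound solvable length₁ length₂ length₃ 4≤k lengthK)
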